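{- For every prime power $q$, the graph $G_{11}$ is a regular graph of degree $q^3-q^2-q$.
   Context: $\mathbb{F}_q$ is the finite field with $q$ elements, $M_2(\mathbb{F}_q)$ is the ring of $2\times 2$ matrices over $\mathbb{F}_q$, $SL_2(\mathbb{F}_q)$ is the set of matrices of determinant $1$, and $GL_2(\mathbb{F}_q)$ the set of invertible matrices. $G_{11}$ is the undirected graph with vertex set $SL_2(\mathbb{F}_q)$ in which $A$ and $B$ are adjacent if and only if $A-B\in GL_2(\mathbb{F}_q)$. -}

module Defs where

open import Level using (0ℓ)
open import Algebra.Bundles using (CommutativeRing)
open import Data.Fin using (Fin)
open import Data.Nat using (ℕ)
open import Data.Product using (Σ; Σ-syntax; _×_; proj₁)
open import Relation.Nullary using (¬_)
open import Relation.Binary.Bundles using (Setoid)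
open import Relation.Binary.PropositionalEquality as ≡ using (_≡_)
open import Function.Bundles using (Inverse)

module _ (R : CommutativeRing 0ℓ 0ℓ) where
  open CommutativeRing R

  IsField : Set
  IsField = (¬ (1# ≈ 0#)) × (∀ x → ¬ (x ≈ 0#) → Σ[ y ∈ Carrier ] (x * y ≈ 1#))

  HasCard : ℕ → Set
  HasCard q = Inverse (setoid) (≡.setoid (Fin q))

  record M2 : Set where
    constructor mat
    field a b c d : Carrier
  open M2 public

  _≈M_ : M2 → M2 → Set
  A ≈M B = (a A ≈ a B) × (b A ≈ b B) × (c A ≈ c B) × (d A ≈ d B)

  _-M_ : M2 → M2 → M2
  A -M B = mat (a A - a B) (b A - b B) (c A - c B) (d A - d B)

  _*M_ : M2 → M2 → M2
  A *M B = mat (a A * a B + b A * c B) (a A * b B + b A * d B)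
               (c A * a B + d A * c B) (c A * b B + d A * d B)

  I2 : M2
  I2 = mat 1# 0# 0# 1#

  det : M2 → Carrier
  det A = a A * d A - b A * c A

  InGL2 : M2 → Set
  InGL2 A = Σ[ B ∈ M2 ] ((A *M B) ≈M I2 × (B *M A) ≈M I2)

  InSL2 : M2 → Set
  InSL2 A = det A ≈ 1#

  SL2 : Set
  SL2 = Σ[ A ∈ M2 ] InSL2 A

  Adj11 : SL2 → SL2 → Set
  Adj11 A B = InGL2 (proj₁ A -M proj₁ B)

  Nbhd11 : SL2 → Setoid 0ℓ 0ℓ
  Nbhd11 A = record
    { Carrier = Σ[ B ∈ SL2 ] Adj11 A B
    ; _≈_ = λ X Y → proj₁ (proj₁ X) ≈M proj₁ (proj₁ Y)
    ; isEquivalence = record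
      { refl = λ {X} → refl , refl , refl , refl
      ; sym = λ (p , q , r , s) → sym p , sym q , sym r , sym s
      ; trans = λ (p , q , r , s) (p' , q' , r' , s') →
          trans p p' , trans q q' , trans r r' , trans s s'
      }
    }
    where open import Data.Product using (_,_)

  G11-Regular : ℕ → Set
  G11-Regular k = (A : SL2) → Inverse (Nbhd11 A) (≡.setoid (Fin k))

{-# OPTIONS --safe #-}
module Submission where

-- For A ∈ SL₂(F), B ↦ adj A · B = A⁻¹B maps the neighbours of A bijectively onto
-- the C ∈ SL₂(F) with tr C ≠ 2, because for A, B ∈ SL₂(F)
--   det (A − B) = det A + det B − tr (adj A · B) = 2 − tr (A⁻¹B).
-- Count those C = (a b; c d) by their diagonal: bc = ad − 1 has q − 1 solutions
-- (b, c), plus q more when ad = 1.  Over the q(q − 1) pairs with a + d ≠ 2 this gives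
-- q(q − 1)², and the pairs with ad = 1, a + d ≠ 2 are the d = a⁻¹ with a ∉ {0, 1},
-- adding q(q − 2).  In total q(q − 1)² + q(q − 2) = q³ − q² − q.

open import Level using (Level; 0ℓ)
open import Algebra.Bundles using (CommutativeRing)
open import Data.Nat as ℕ using (ℕ; zero; suc; _^_; _∸_)
import Data.Nat.Properties as ℕ
open import Data.Nat.Primality using (Prime)
open import Data.Product using (Σ-syntax; _×_; _,_; proj₁; proj₂)
open import Relation.Binary.PropositionalEquality as ≡ using (_≡_)
import Relation.Binary.Definitions
open import Data.Fin using (Fin)
open import Function.Bundles using (Inverse)
import Function.Construct.Composition as Composition
open import Defs using (IsField; HasCard; G11-Regular; M2; mat; a; b; c; d; SL2; Nbhd11)
import Defs

-- Tactic.RingSolver over an abstract ring takes its coefficients in the ring itself,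
-- where it cannot see that 1 - 1 cancels; coefficients in ℤ, interpreted through the
-- canonical morphism ℤ → R, give a complete solver for commutative-ring identities.
module IntegerCoefficientRingSolver {c ℓ : Level} (R : CommutativeRing c ℓ) where
  open CommutativeRing R
  open import Data.Bool using (Bool; true; false; T)
  open import Data.Maybe using (nothing)
  open import Data.Integer as ℤ using (ℤ; +_; -[1+_]; _⊖_; sign; ∣_∣; _◃_)
  import Data.Integer.Properties as ℤ
  open import Data.Sign as Sign using (Sign)
  open import Data.Vec using (Vec)
  open import Algebra.Properties.Ring ring using (-1*x≈-x; -‿distribʳ-*; -‿involutive; -0#≈0#)
  open import Algebra.Properties.AbelianGroup +-abelianGroup using (⁻¹-∙-comm)
  open import Algebra.Properties.Semiring.Mult.TCOptimised semiring using (1+×; ×-homo-+; ×1-homo-*) renaming (_×_ to _×ᵣ_)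
  open import Algebra.Properties.CommutativeSemigroup *-commutativeSemigroup using (interchange)
  open import Algebra.Properties.CommutativeSemigroup +-commutativeSemigroup using () renaming (interchange to +-interchange)
  open import Relation.Binary.Reasoning.Setoid setoid
  open import Tactic.RingSolver.Core.AlmostCommutativeRing using (fromCommutativeRing)
  open import Tactic.RingSolver.Core.Polynomial.Parameters using (Homomorphism)
  open import Tactic.RingSolver.Core.Expression public using (Expr; Κ; Ι; _⊕_; _⊗_; ⊝_; _⊛_)
  open import Tactic.RingSolver.Core.Expression using (module Eval)

  -- The optimised _×_ has 1 × x = x definitionally, so the solver's constant Κ (+ 1)
  -- denotes 1# itself and goals mentioning 1# normalise as expected.
  ⟦_⟧ℤ : ℤ → Carrier
  ⟦ + n ⟧ℤ      = n ×ᵣ 1#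
  ⟦ -[1+ n ] ⟧ℤ = - (suc n ×ᵣ 1#)

  ⟦⊖⟧ : ∀ m n → ⟦ m ⊖ n ⟧ℤ ≈ m ×ᵣ 1# - n ×ᵣ 1#
  ⟦⊖⟧ m zero = begin
    ⟦ m ⊖ 0 ⟧ℤ      ≡⟨ ≡.cong ⟦_⟧ℤ (ℤ.⊖-≥ {m} ℕ.z≤n) ⟩
    m ×ᵣ 1#         ≈⟨ +-identityʳ _ ⟨
    m ×ᵣ 1# + 0#    ≈⟨ +-congˡ -0#≈0# ⟨
    m ×ᵣ 1# - 0#    ∎
  ⟦⊖⟧ zero (suc n) = sym (+-identityˡ _)
  ⟦⊖⟧ (suc m) (suc n) = begin
    ⟦ suc m ⊖ suc n ⟧ℤ                 ≡⟨ ≡.cong ⟦_⟧ℤ (ℤ.[1+m]⊖[1+n]≡m⊖n m n) ⟩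
    ⟦ m ⊖ n ⟧ℤ                         ≈⟨ ⟦⊖⟧ m n ⟩
    m ×ᵣ 1# - n ×ᵣ 1#                  ≈⟨ +-identityˡ _ ⟨
    0# + (m ×ᵣ 1# - n ×ᵣ 1#)           ≈⟨ +-congʳ (-‿inverseʳ 1#) ⟨
    (1# - 1#) + (m ×ᵣ 1# - n ×ᵣ 1#)    ≈⟨ +-interchange _ _ _ _ ⟩
    (1# + m ×ᵣ 1#) + (- 1# - n ×ᵣ 1#)  ≈⟨ +-congˡ (⁻¹-∙-comm _ _) ⟩
    (1# + m ×ᵣ 1#) - (1# + n ×ᵣ 1#)    ≈⟨ +-cong (1+× m 1#) (-‿cong (1+× n 1#)) ⟨
    suc m ×ᵣ 1# - suc n ×ᵣ 1#          ∎

  ⟦-+⟧ : ∀ n → ⟦ ℤ.- (+ n) ⟧ℤ ≈ - (n ×ᵣ 1#)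
  ⟦-+⟧ zero    = sym -0#≈0#
  ⟦-+⟧ (suc n) = refl

  ⟦_⟧ₛ : Sign → Carrier
  ⟦ Sign.+ ⟧ₛ = 1#
  ⟦ Sign.- ⟧ₛ = - 1#

  ⟦◃⟧ : ∀ s n → ⟦ s ◃ n ⟧ℤ ≈ ⟦ s ⟧ₛ * (n ×ᵣ 1#)
  ⟦◃⟧ Sign.+ n = begin
    ⟦ Sign.+ ◃ n ⟧ℤ   ≡⟨ ≡.cong ⟦_⟧ℤ (ℤ.+◃n≡+n n) ⟩
    n ×ᵣ 1#           ≈⟨ *-identityˡ _ ⟨
    1# * (n ×ᵣ 1#)    ∎
  ⟦◃⟧ Sign.- n = begin
    ⟦ Sign.- ◃ n ⟧ℤ   ≡⟨ ≡.cong ⟦_⟧ℤ (ℤ.-◃n≡-n n) ⟩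
    ⟦ ℤ.- (+ n) ⟧ℤ    ≈⟨ ⟦-+⟧ n ⟩
    - (n ×ᵣ 1#)       ≈⟨ -1*x≈-x _ ⟨
    - 1# * (n ×ᵣ 1#)  ∎

  ⟦⟧-sign-abs : ∀ i → ⟦ i ⟧ℤ ≈ ⟦ sign i ⟧ₛ * (∣ i ∣ ×ᵣ 1#)
  ⟦⟧-sign-abs i = trans (reflexive (≡.cong ⟦_⟧ℤ (≡.sym (ℤ.◃-inverse i)))) (⟦◃⟧ (sign i) ∣ i ∣)

  ⟦⟧ₛ-homo-* : ∀ s t → ⟦ s Sign.* t ⟧ₛ ≈ ⟦ s ⟧ₛ * ⟦ t ⟧ₛ
  ⟦⟧ₛ-homo-* Sign.+ t      = sym (*-identityˡ _)
  ⟦⟧ₛ-homo-* Sign.- Sign.+ = sym (*-identityʳ _)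
  ⟦⟧ₛ-homo-* Sign.- Sign.- = begin
    1#            ≈⟨ -‿involutive 1# ⟨
    - - 1#        ≈⟨ -‿cong (-1*x≈-x 1#) ⟨
    - (- 1# * 1#) ≈⟨ -‿distribʳ-* _ _ ⟩
    - 1# * - 1#   ∎

  ⟦⟧-homo-+ : ∀ i j → ⟦ i ℤ.+ j ⟧ℤ ≈ ⟦ i ⟧ℤ + ⟦ j ⟧ℤ
  ⟦⟧-homo-+ (+ m)    (+ n)    = ×-homo-+ 1# m n
  ⟦⟧-homo-+ (+ m)    -[1+ n ] = ⟦⊖⟧ m (suc n)
  ⟦⟧-homo-+ -[1+ m ] (+ n)    = trans (⟦⊖⟧ n (suc m)) (+-comm _ _)
  ⟦⟧-homo-+ -[1+ m ] -[1+ n ] = begin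
    - (suc (suc (m ℕ.+ n)) ×ᵣ 1#)        ≡⟨ ≡.cong (λ k → - (suc k ×ᵣ 1#)) (ℕ.+-suc m n) ⟨
    - ((suc m ℕ.+ suc n) ×ᵣ 1#)          ≈⟨ -‿cong (×-homo-+ 1# (suc m) (suc n)) ⟩
    - (suc m ×ᵣ 1# + suc n ×ᵣ 1#)        ≈⟨ ⁻¹-∙-comm _ _ ⟨
    - (suc m ×ᵣ 1#) - (suc n ×ᵣ 1#)      ∎

  ⟦⟧-homo-* : ∀ i j → ⟦ i ℤ.* j ⟧ℤ ≈ ⟦ i ⟧ℤ * ⟦ j ⟧ℤ
  ⟦⟧-homo-* i j = begin
    ⟦ (sign i Sign.* sign j) ◃ (∣ i ∣ ℕ.* ∣ j ∣) ⟧ℤ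
      ≈⟨ ⟦◃⟧ (sign i Sign.* sign j) (∣ i ∣ ℕ.* ∣ j ∣) ⟩
    ⟦ sign i Sign.* sign j ⟧ₛ * ((∣ i ∣ ℕ.* ∣ j ∣) ×ᵣ 1#)
      ≈⟨ *-cong (⟦⟧ₛ-homo-* (sign i) (sign j)) (×1-homo-* ∣ i ∣ ∣ j ∣) ⟩
    (⟦ sign i ⟧ₛ * ⟦ sign j ⟧ₛ) * ((∣ i ∣ ×ᵣ 1#) * (∣ j ∣ ×ᵣ 1#))
      ≈⟨ interchange _ _ _ _ ⟩
    (⟦ sign i ⟧ₛ * (∣ i ∣ ×ᵣ 1#)) * (⟦ sign j ⟧ₛ * (∣ j ∣ ×ᵣ 1#))
      ≈⟨ *-cong (⟦⟧-sign-abs i) (⟦⟧-sign-abs j) ⟨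
    ⟦ i ⟧ℤ * ⟦ j ⟧ℤ
      ∎

  ⟦⟧-homo-‿- : ∀ i → ⟦ ℤ.- i ⟧ℤ ≈ - ⟦ i ⟧ℤ
  ⟦⟧-homo-‿- (+ n)    = ⟦-+⟧ n
  ⟦⟧-homo-‿- -[1+ n ] = sym (-‿involutive _)

  private
    isZero : ℤ → Bool
    isZero (+ zero) = true
    isZero _        = false

    isZero-sound : ∀ i → T (isZero i) → 0# ≈ ⟦ i ⟧ℤ
    isZero-sound (+ zero) _ = refl

  ℤ⟶R : Homomorphism 0ℓ 0ℓ c ℓ
  ℤ⟶R = record
    { from = record { rawRing = ℤ.+-*-rawRing ; isZero = isZero }
    ; to = fromCommutativeRing R (λ _ → nothing)
    ; morphism = record
      { ⟦_⟧ = ⟦_⟧ℤ ; +-homo = ⟦⟧-homo-+ ; *-homo = ⟦⟧-homo-* ; -‿homo = ⟦⟧-homo-‿-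
      ; 0-homo = refl ; 1-homo = refl }
    ; Zero-C⟶Zero-R = isZero-sound
    }

  open Eval rawRing ⟦_⟧ℤ using (⟦_⟧)
  open import Tactic.RingSolver.Core.Polynomial.Base (Homomorphism.from ℤ⟶R) using (Poly; κ; ι; _⊞_; _⊠_; ⊟_; _⊡_)
  open import Tactic.RingSolver.Core.Polynomial.Semantics ℤ⟶R renaming (⟦_⟧ to ⟦_⟧ₚ)
  open import Tactic.RingSolver.Core.Polynomial.Homomorphism ℤ⟶R
  open import Algebra.Properties.Semiring.Exp.TCOptimised semiring using (^-congˡ)

  normalise : ∀ {n} → Expr ℤ n → Poly n
  normalise (Κ x)   = κ x
  normalise (Ι x)   = ι x
  normalise (x ⊕ y) = normalise x ⊞ normalise y
  normalise (x ⊗ y) = normalise x ⊠ normalise y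
  normalise (⊝ x)   = ⊟ normalise x
  normalise (x ⊛ i) = normalise x ⊡ i

  ⟦_⇓⟧ : ∀ {n} → Expr ℤ n → Vec Carrier n → Carrier
  ⟦ e ⇓⟧ = ⟦ normalise e ⟧ₚ

  normalise-correct : ∀ {n} (e : Expr ℤ n) ρ → ⟦ e ⇓⟧ ρ ≈ ⟦ e ⟧ ρ
  normalise-correct (Κ x)   ρ = κ-hom x ρ
  normalise-correct (Ι x)   ρ = ι-hom x ρ
  normalise-correct (x ⊕ y) ρ =
    trans (⊞-hom (normalise x) (normalise y) ρ) (+-cong (normalise-correct x ρ) (normalise-correct y ρ))
  normalise-correct (x ⊗ y) ρ =
    trans (⊠-hom (normalise x) (normalise y) ρ) (*-cong (normalise-correct x ρ) (normalise-correct y ρ))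
  normalise-correct (⊝ x)   ρ = trans (⊟-hom (normalise x) ρ) (-‿cong (normalise-correct x ρ))
  normalise-correct (x ⊛ i) ρ = trans (⊡-hom (normalise x) i ρ) (^-congˡ i (normalise-correct x ρ))

  open import Relation.Binary.Reflection setoid Ι ⟦_⟧ ⟦_⇓⟧ normalise-correct public using (solve)

  infix 4 _⊜_
  _⊜_ : ∀ {n} → Expr ℤ n → Expr ℤ n → Expr ℤ n × Expr ℤ n
  _⊜_ = _,_

  0ₑ 1ₑ : ∀ {n} → Expr ℤ n
  0ₑ = Κ (+ 0)
  1ₑ = Κ (+ 1)

module FinCounting where
  open import Data.Fin as Fin using (zero; suc; _↑ˡ_; _↑ʳ_; combine; remQuot)
  import Data.Fin.Properties as FinP
  open import Data.Product using (map₂; uncurry)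
  open import Data.Empty using (⊥-elim)
  open import Function using (_∘_)
  open import Function.Bundles using (Equivalence; _⇔_; mk⇔)
  open import Relation.Nullary using (Dec; yes; no; ¬_)
  open import Relation.Nullary.Decidable using (¬?; _×-dec_)
  open import Relation.Unary using (Pred; Decidable)
  open import Relation.Binary.Definitions using (_Respects_)
  open import Relation.Binary.Bundles using (Setoid)
  import Relation.Binary.Construct.On as On
  open import Algebra.Properties.Semiring.Sum ℕ.+-*-semiring public using (sum-syntax; sum-cong-≗; ∑-distrib-+; *-distribˡ-sum)
  open ≡ using (refl; cong)
  open ≡.≡-Reasoning

  iverson : ∀ {p} {P : Set p} → Dec P → ℕ
  iverson (yes _) = 1
  iverson (no _)  = 0

  module _ {p q} {P : Set p} {Q : Set q} where

    iverson-cong : (P? : Dec P) (Q? : Dec Q) → P ⇔ Q → iverson P? ≡ iverson Q?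
    iverson-cong (yes _) (yes _) _   = refl
    iverson-cong (yes p) (no ¬q) P⇔Q = ⊥-elim (¬q (Equivalence.to P⇔Q p))
    iverson-cong (no ¬p) (yes q) P⇔Q = ⊥-elim (¬p (Equivalence.from P⇔Q q))
    iverson-cong (no _)  (no _)  _   = refl

    iverson-× : (P? : Dec P) (Q? : Dec Q) → iverson (P? ×-dec Q?) ≡ iverson P? ℕ.* iverson Q?
    iverson-× (yes _) (yes _) = refl
    iverson-× (yes _) (no _)  = refl
    iverson-× (no _)  _       = refl

  module _ {p} {P : Set p} where

    iverson-no : (P? : Dec P) → ¬ P → iverson P? ≡ 0
    iverson-no (yes p) ¬p = ⊥-elim (¬p p)
    iverson-no (no _)  _  = refl

    iverson-+-¬ : (P? : Dec P) → iverson P? ℕ.+ iverson (¬? P?) ≡ 1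
    iverson-+-¬ (yes _) = refl
    iverson-+-¬ (no _)  = refl

  ∑-const : ∀ n k → ∑[ i < n ] k ≡ n ℕ.* k
  ∑-const zero    k = refl
  ∑-const (suc n) k = cong (k ℕ.+_) (∑-const n k)

  ∑-↑ : ∀ m n (f : Fin (m ℕ.+ n) → ℕ) →
        ∑[ i < m ℕ.+ n ] f i ≡ ∑[ i < m ] f (i ↑ˡ n) ℕ.+ ∑[ j < n ] f (m ↑ʳ j)
  ∑-↑ zero    n f = refl
  ∑-↑ (suc m) n f = ≡.trans (cong (f zero ℕ.+_) (∑-↑ m n (f ∘ suc))) (≡.sym (ℕ.+-assoc (f zero) _ _))

  ∑-combine : ∀ m n (f : Fin (m ℕ.* n) → ℕ) →
              ∑[ k < m ℕ.* n ] f k ≡ ∑[ i < m ] ∑[ j < n ] f (combine i j)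
  ∑-combine zero    n f = refl
  ∑-combine (suc m) n f =
    ≡.trans (∑-↑ n (m ℕ.* n) f) (cong (∑[ j < n ] f (j ↑ˡ m ℕ.* n) ℕ.+_) (∑-combine m n (f ∘ (n ↑ʳ_))))

  ∑-δ : ∀ n (k : Fin n) → ∑[ i < n ] iverson (i Fin.≟ k) ≡ 1
  ∑-δ (suc n) zero    = cong suc (≡.trans (∑-const n 0) (ℕ.*-zeroʳ n))
  ∑-δ (suc n) (suc k) = ≡.trans
    (sum-cong-≗ λ i → iverson-cong (suc i Fin.≟ suc k) (i Fin.≟ k) (mk⇔ FinP.suc-injective (cong suc)))
    (∑-δ n k)

  count : ∀ {n} {P : Pred (Fin n) 0ℓ} → Decidable P → ℕ
  count {n} P? = ∑[ i < n ] iverson (P? i)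

  _↾_ : ∀ {a ℓ p} (S : Setoid a ℓ) (P : Pred (Setoid.Carrier S) p) → Setoid _ ℓ
  S ↾ P = On.setoid S (proj₁ {B = P})

  module _ {n} {P : Pred (Fin (suc n)) 0ℓ} where
    CountAfter : Decidable P → Dec (P zero) → ℕ
    CountAfter P? P₀? = iverson P₀? ℕ.+ count (P? ∘ suc)

  toCount   : ∀ {n} {P : Pred (Fin n) 0ℓ} (P? : Decidable P) → Σ[ i ∈ Fin n ] P i → Fin (count P?)
  toCount′  : ∀ {n} {P : Pred (Fin (suc n)) 0ℓ} (P? : Decidable P) (P₀? : Dec (P zero)) →
              Σ[ i ∈ Fin (suc n) ] P i → Fin (CountAfter P? P₀?)
  fromCount  : ∀ {n} {P : Pred (Fin n) 0ℓ} (P? : Decidable P) → Fin (count P?) → Σ[ i ∈ Fin n ] P i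
  fromCount′ : ∀ {n} {P : Pred (Fin (suc n)) 0ℓ} (P? : Decidable P) (P₀? : Dec (P zero)) →
               Fin (CountAfter P? P₀?) → Σ[ i ∈ Fin (suc n) ] P i

  toCount {suc n} P? = toCount′ P? (P? zero)
  toCount′ P? (yes _) (zero , _)  = zero
  toCount′ P? (no ¬p) (zero , p)  = ⊥-elim (¬p p)
  toCount′ P? (yes _) (suc i , p) = suc (toCount (P? ∘ suc) (i , p))
  toCount′ P? (no _)  (suc i , p) = toCount (P? ∘ suc) (i , p)

  fromCount {suc n} P? = fromCount′ P? (P? zero)
  fromCount′ P? (yes p) zero    = zero , p
  fromCount′ P? (yes _) (suc k) = let (i , p) = fromCount (P? ∘ suc) k in suc i , p
  fromCount′ P? (no _)  k       = let (i , p) = fromCount (P? ∘ suc) k in suc i , p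

  toCount-irrelevant : ∀ {n} {P : Pred (Fin n) 0ℓ} (P? : Decidable P) {i} (p p′ : P i) →
                       toCount P? (i , p) ≡ toCount P? (i , p′)
  toCount-irrelevant {suc n} {P} P? = go (P? zero)
    where
    go : (P₀? : Dec (P zero)) {i : Fin (suc n)} (p p′ : P i) → toCount′ P? P₀? (i , p) ≡ toCount′ P? P₀? (i , p′)
    go (yes _) {zero}  p p′ = refl
    go (no ¬p) {zero}  p p′ = ⊥-elim (¬p p)
    go (yes _) {suc i} p p′ = cong suc (toCount-irrelevant (P? ∘ suc) p p′)
    go (no _)  {suc i} p p′ = toCount-irrelevant (P? ∘ suc) p p′

  toCount-fromCount : ∀ {n} {P : Pred (Fin n) 0ℓ} (P? : Decidable P) k → toCount P? (fromCount P? k) ≡ k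
  toCount-fromCount {suc n} {P} P? = go (P? zero)
    where
    go : (P₀? : Dec (P zero)) → ∀ k → toCount′ P? P₀? (fromCount′ P? P₀? k) ≡ k
    go (yes _) zero    = refl
    go (yes _) (suc k) = cong suc (toCount-fromCount (P? ∘ suc) k)
    go (no _)  k       = toCount-fromCount (P? ∘ suc) k

  fromCount-toCount : ∀ {n} {P : Pred (Fin n) 0ℓ} (P? : Decidable P) x → proj₁ (fromCount P? (toCount P? x)) ≡ proj₁ x
  fromCount-toCount {suc n} {P} P? = go (P? zero)
    where
    go : (P₀? : Dec (P zero)) → ∀ x → proj₁ (fromCount′ P? P₀? (toCount′ P? P₀? x)) ≡ proj₁ x
    go (yes _) (zero , _)  = refl
    go (no ¬p) (zero , p)  = ⊥-elim (¬p p)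
    go (yes _) (suc i , p) = cong suc (fromCount-toCount (P? ∘ suc) (i , p))
    go (no _)  (suc i , p) = cong suc (fromCount-toCount (P? ∘ suc) (i , p))

  ↾↔count : ∀ {n} {P : Pred (Fin n) 0ℓ} (P? : Decidable P) → Inverse (≡.setoid (Fin n) ↾ P) (≡.setoid (Fin (count P?)))
  ↾↔count P? = record
    { to        = toCount P?
    ; from      = fromCount P?
    ; to-cong   = toCount-cong
    ; from-cong = cong (proj₁ ∘ fromCount P?)
    ; inverse   = (λ {k} {x} x≈k → ≡.trans (toCount-cong x≈k) (toCount-fromCount P? k))
                , (λ {x} {k} k≡x → ≡.trans (cong (proj₁ ∘ fromCount P?) k≡x) (fromCount-toCount P? x))
    }
    where
    toCount-cong : ∀ {x y} → proj₁ x ≡ proj₁ y → toCount P? x ≡ toCount P? y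
    toCount-cong {i , p} {.i , p′} refl = toCount-irrelevant P? p p′

  pair⁴ : ∀ {n} → Fin n × Fin n × Fin n × Fin n → Fin (n ℕ.* (n ℕ.* (n ℕ.* n)))
  pair⁴ (i , l , j , m) = combine i (combine l (combine j m))

  unpair⁴ : ∀ n → Fin (n ℕ.* (n ℕ.* (n ℕ.* n))) → Fin n × Fin n × Fin n × Fin n
  unpair⁴ n k = map₂ (map₂ (remQuot {n} n) ∘ remQuot {n} (n ℕ.* n)) (remQuot {n} (n ℕ.* (n ℕ.* n)) k)

  unpair⁴-pair⁴ : ∀ {n} (e : Fin n × Fin n × Fin n × Fin n) → unpair⁴ n (pair⁴ e) ≡ e
  unpair⁴-pair⁴ {n} (i , l , j , m) = begin
    unpair⁴ n (combine i (combine l (combine j m)))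
      ≡⟨ ≡.cong (map₂ (map₂ (remQuot n) ∘ remQuot (n ℕ.* n))) (FinP.remQuot-combine i (combine l (combine j m))) ⟩
    (i , map₂ (remQuot n) (remQuot (n ℕ.* n) (combine l (combine j m))))
      ≡⟨ ≡.cong (λ p → i , map₂ (remQuot n) p) (FinP.remQuot-combine l (combine j m)) ⟩
    (i , l , remQuot n (combine j m))
      ≡⟨ ≡.cong (λ p → i , l , p) (FinP.remQuot-combine j m) ⟩
    (i , l , j , m)
      ∎

  pair⁴-unpair⁴ : ∀ n (k : Fin (n ℕ.* (n ℕ.* (n ℕ.* n)))) → pair⁴ (unpair⁴ n k) ≡ k
  pair⁴-unpair⁴ n k = begin
    combine i (combine l (uncurry combine (remQuot {n} n r₂)))
      ≡⟨ ≡.cong (λ r → combine i (combine l r)) (FinP.combine-remQuot {n} n r₂) ⟩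
    combine i (uncurry combine (remQuot {n} (n ℕ.* n) r₁))
      ≡⟨ ≡.cong (combine i) (FinP.combine-remQuot {n} (n ℕ.* n) r₁) ⟩
    uncurry combine (remQuot {n} (n ℕ.* (n ℕ.* n)) k)
      ≡⟨ FinP.combine-remQuot {n} (n ℕ.* (n ℕ.* n)) k ⟩
    k
      ∎
    where
    i l : Fin n
    r₁ : Fin (n ℕ.* (n ℕ.* n))
    r₂ : Fin (n ℕ.* n)
    i  = proj₁ (remQuot {n} (n ℕ.* (n ℕ.* n)) k)
    r₁ = proj₂ (remQuot {n} (n ℕ.* (n ℕ.* n)) k)
    l  = proj₁ (remQuot {n} (n ℕ.* n) r₁)
    r₂ = proj₂ (remQuot {n} (n ℕ.* n) r₁)

  module _ {S : Setoid 0ℓ 0ℓ} {n} (enum : Inverse S (≡.setoid (Fin n)))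
           {P : Pred (Setoid.Carrier S) 0ℓ} (P? : Decidable P) (P-resp : P Respects Setoid._≈_ S) where
    open Inverse enum

    ↾-transport : Inverse (S ↾ P) (≡.setoid (Fin n) ↾ (P ∘ from))
    ↾-transport = record
      { to        = λ (x , p) → to x , P-resp (Setoid.sym S (strictlyInverseʳ x)) p
      ; from      = λ (i , p) → from i , p
      ; to-cong   = to-cong
      ; from-cong = from-cong
      ; inverse   = inverseˡ , inverseʳ
      }

    ↾↔∑ : Inverse (S ↾ P) (≡.setoid (Fin (∑[ i < n ] iverson (P? (from i)))))
    ↾↔∑ = Composition.inverse ↾-transport (↾↔count (P? ∘ from))

q*m+q*[q-1]²≡q³-q²-q : ∀ {m q} → 2 ℕ.+ m ≡ q → q ℕ.* m ℕ.+ q ℕ.* ((q ∸ 1) ℕ.* (q ∸ 1)) ≡ q ^ 3 ∸ q ^ 2 ∸ q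
q*m+q*[q-1]²≡q³-q²-q {m} ≡.refl = begin
  X                              ≡⟨ ℕ.m+n∸n≡m X q ⟨
  X ℕ.+ q ∸ q                    ≡⟨ ≡.cong (_∸ q) (ℕ.m+n∸n≡m (X ℕ.+ q) (q ^ 2)) ⟨
  X ℕ.+ q ℕ.+ q ^ 2 ∸ q ^ 2 ∸ q  ≡⟨ ≡.cong (λ n → n ∸ q ^ 2 ∸ q) (cube m) ⟩
  q ^ 3 ∸ q ^ 2 ∸ q              ∎
  where
  open ≡.≡-Reasoning
  open import Data.Nat.Tactic.RingSolver using (solve-∀)
  q = 2 ℕ.+ m
  X = q ℕ.* m ℕ.+ q ℕ.* ((q ∸ 1) ℕ.* (q ∸ 1))
  cube : ∀ m → let q = 2 ℕ.+ m in
         q ℕ.* m ℕ.+ q ℕ.* ((1 ℕ.+ m) ℕ.* (1 ℕ.+ m)) ℕ.+ q ℕ.+ q ℕ.* (q ℕ.* 1) ≡ q ℕ.* (q ℕ.* (q ℕ.* 1))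
  cube = solve-∀

module DiscreteField (F : CommutativeRing 0ℓ 0ℓ) (isField : IsField F)
                     (_≟_ : Relation.Binary.Definitions.Decidable (CommutativeRing._≈_ F)) where
  open CommutativeRing F
  open IntegerCoefficientRingSolver F
  open import Relation.Nullary using (¬_; yes; no)
  open import Function.Bundles using (_⇔_; mk⇔)
  open import Algebra.Properties.Group +-group using (x∙y⁻¹≈ε⇒x≈y; x≈y⇒x∙y⁻¹≈ε)
  open import Relation.Binary.Reasoning.Setoid setoid

  1≉0 : ¬ (1# ≈ 0#)
  1≉0 = proj₁ isField

  x*y≈1⇒y*[x*z]≈z : ∀ {x y} z → x * y ≈ 1# → y * (x * z) ≈ z
  x*y≈1⇒y*[x*z]≈z {x} {y} z xy≈1 = begin
    y * (x * z) ≈⟨ solve 3 (λ x y z → y ⊗ (x ⊗ z) ⊜ (x ⊗ y) ⊗ z) refl x y z ⟩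
    (x * y) * z ≈⟨ *-congʳ xy≈1 ⟩
    1# * z      ≈⟨ *-identityˡ z ⟩
    z           ∎

  x*y≈1⇒x*[y*z]≈z : ∀ {x y} z → x * y ≈ 1# → x * (y * z) ≈ z
  x*y≈1⇒x*[y*z]≈z {x} {y} z xy≈1 = x*y≈1⇒y*[x*z]≈z z (trans (*-comm y x) xy≈1)

  x*x≈0⇒x≈0 : ∀ {x} → x * x ≈ 0# → x ≈ 0#
  x*x≈0⇒x≈0 {x} xx≈0 with x ≟ 0#
  ... | yes x≈0 = x≈0
  ... | no x≉0  = let (y , xy≈1) = proj₂ isField x x≉0 in begin
    x           ≈⟨ x*y≈1⇒y*[x*z]≈z x xy≈1 ⟨
    y * (x * x) ≈⟨ *-congˡ xx≈0 ⟩
    y * 0#      ≈⟨ zeroʳ y ⟩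
    0#          ∎

  x*y≈1⇒[x+y≈2⇒x≈1] : ∀ {x y} → x * y ≈ 1# → x + y ≈ 1# + 1# → x ≈ 1#
  x*y≈1⇒[x+y≈2⇒x≈1] {x} {y} xy≈1 x+y≈2 = x∙y⁻¹≈ε⇒x≈y x 1# (x*x≈0⇒x≈0 (begin
    (x - 1#) * (x - 1#)                        ≈⟨ expand ⟩
    x * (x + y) - x * (1# + 1#) + (1# - x * y) ≈⟨ +-cong (+-congʳ (*-congˡ x+y≈2)) (+-congˡ (-‿cong xy≈1)) ⟩
    x * (1# + 1#) - x * (1# + 1#) + (1# - 1#)  ≈⟨ +-cong (-‿inverseʳ _) (-‿inverseʳ _) ⟩
    0# + 0#                                    ≈⟨ +-identityˡ 0# ⟩
    0#                                         ∎))
    where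
    expand : (x - 1#) * (x - 1#) ≈ x * (x + y) - x * (1# + 1#) + (1# - x * y)
    expand = solve 2 (λ x y → (x ⊕ ⊝ 1ₑ) ⊗ (x ⊕ ⊝ 1ₑ) ⊜ x ⊗ (x ⊕ y) ⊕ ⊝ (x ⊗ (1ₑ ⊕ 1ₑ)) ⊕ (1ₑ ⊕ ⊝ (x ⊗ y))) refl x y

  x*y≈1⇒[x*z≈w⇔z≈y*w] : ∀ {x y z w} → x * y ≈ 1# → (x * z ≈ w) ⇔ (z ≈ y * w)
  x*y≈1⇒[x*z≈w⇔z≈y*w] {x} {y} {z} {w} xy≈1 = mk⇔
    (λ xz≈w → trans (sym (x*y≈1⇒y*[x*z]≈z z xy≈1)) (*-congˡ xz≈w))
    (λ z≈yw → trans (*-congˡ z≈yw) (x*y≈1⇒x*[y*z]≈z w xy≈1))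

  x*y≈1⇒[x*z≈1⇔z≈y] : ∀ {x y z} → x * y ≈ 1# → (x * z ≈ 1#) ⇔ (z ≈ y)
  x*y≈1⇒[x*z≈1⇔z≈y] {x} {y} {z} xy≈1 = mk⇔
    (λ xz≈1 → trans (sym (x*y≈1⇒y*[x*z]≈z z xy≈1)) (trans (*-congˡ xz≈1) (*-identityʳ y)))
    (λ z≈y → trans (*-congˡ z≈y) xy≈1)

  x-y≈z⇔y≈x-z : ∀ {x y z} → (x - y ≈ z) ⇔ (y ≈ x - z)
  x-y≈z⇔y≈x-z {x} {y} {z} = mk⇔
    (λ x-y≈z → trans (solve 2 (λ x y → y ⊜ x ⊕ ⊝ (x ⊕ ⊝ y)) refl x y) (+-congˡ (-‿cong x-y≈z)))
    (λ y≈x-z → trans (+-congˡ (-‿cong y≈x-z)) (solve 2 (λ x z → x ⊕ ⊝ (x ⊕ ⊝ z) ⊜ z) refl x z))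

  x+y≈z⇔y≈z-x : ∀ {x y z} → (x + y ≈ z) ⇔ (y ≈ z - x)
  x+y≈z⇔y≈z-x {x} {y} {z} = mk⇔
    (λ x+y≈z → trans (solve 2 (λ x y → y ⊜ (x ⊕ y) ⊕ ⊝ x) refl x y) (+-congʳ x+y≈z))
    (λ y≈z-x → trans (+-congˡ y≈z-x) (solve 2 (λ x z → x ⊕ (z ⊕ ⊝ x) ⊜ z) refl x z))

  x-y≈0⇔x≈y : ∀ {x y} → (x - y ≈ 0#) ⇔ (x ≈ y)
  x-y≈0⇔x≈y = mk⇔ (x∙y⁻¹≈ε⇒x≈y _ _) x≈y⇒x∙y⁻¹≈ε

module Matrices (F : CommutativeRing 0ℓ 0ℓ) (isField : IsField F) where
  open CommutativeRing F
  open IntegerCoefficientRingSolver F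
  open FinCounting using (_↾_)
  open import Data.Integer using (ℤ)
  open import Algebra.Properties.Group +-group using (x∙y⁻¹≈ε⇒x≈y)
  open import Relation.Nullary using (¬_)
  open import Relation.Binary.Bundles using (Setoid)
  open import Relation.Binary.Definitions using (_Respects_)
  open import Relation.Binary.Reasoning.Setoid setoid
  import Relation.Binary.Construct.On as On
  open import Data.Product.Relation.Binary.Pointwise.NonDependent using (_×ₛ_)

  infix  4 _≈M_
  infixl 6 _-M_
  infixl 7 _*M_ _•M_

  _≈M_ : M2 F → M2 F → Set
  _≈M_ = Defs._≈M_ F

  _-M_ _*M_ : M2 F → M2 F → M2 F
  _-M_ = Defs._-M_ F
  _*M_ = Defs._*M_ F

  I2 : M2 F
  I2 = Defs.I2 F

  det : M2 F → Carrier
  det = Defs.det F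

  InGL2 : M2 F → Set
  InGL2 = Defs.InGL2 F

  2# : Carrier
  2# = 1# + 1#

  tr : M2 F → Carrier
  tr X = a X + d X

  adj : M2 F → M2 F
  adj X = mat (d X) (- b X) (- c X) (a X)

  _•M_ : Carrier → M2 F → M2 F
  k •M X = mat (k * a X) (k * b X) (k * c X) (k * d X)

  M2-setoid : Setoid 0ℓ 0ℓ
  M2-setoid = On.setoid (setoid ×ₛ (setoid ×ₛ (setoid ×ₛ setoid))) (λ (X : M2 F) → a X , b X , c X , d X)

  module ≈M = Setoid M2-setoid

  private
    record M2ₑ (n : ℕ) : Set where
      constructor matₑ
      field aₑ bₑ cₑ dₑ : Expr ℤ n
    open M2ₑ

    _*ₑ_ : ∀ {n} → M2ₑ n → M2ₑ n → M2ₑ n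
    X *ₑ Y = matₑ (aₑ X ⊗ aₑ Y ⊕ bₑ X ⊗ cₑ Y) (aₑ X ⊗ bₑ Y ⊕ bₑ X ⊗ dₑ Y)
                  (cₑ X ⊗ aₑ Y ⊕ dₑ X ⊗ cₑ Y) (cₑ X ⊗ bₑ Y ⊕ dₑ X ⊗ dₑ Y)

    _-ₑ_ : ∀ {n} → M2ₑ n → M2ₑ n → M2ₑ n
    X -ₑ Y = matₑ (aₑ X ⊕ ⊝ aₑ Y) (bₑ X ⊕ ⊝ bₑ Y) (cₑ X ⊕ ⊝ cₑ Y) (dₑ X ⊕ ⊝ dₑ Y)

    _•ₑ_ : ∀ {n} → Expr ℤ n → M2ₑ n → M2ₑ n
    k •ₑ X = matₑ (k ⊗ aₑ X) (k ⊗ bₑ X) (k ⊗ cₑ X) (k ⊗ dₑ X)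

    detₑ trₑ : ∀ {n} → M2ₑ n → Expr ℤ n
    detₑ X = aₑ X ⊗ dₑ X ⊕ ⊝ (bₑ X ⊗ cₑ X)
    trₑ X = aₑ X ⊕ dₑ X

    adjₑ : ∀ {n} → M2ₑ n → M2ₑ n
    adjₑ X = matₑ (dₑ X) (⊝ bₑ X) (⊝ cₑ X) (aₑ X)

    withM : ∀ {A : Set} → (M2ₑ 4 → A) → Expr ℤ 4 → Expr ℤ 4 → Expr ℤ 4 → Expr ℤ 4 → A
    withM f a₁ b₁ c₁ d₁ = f (matₑ a₁ b₁ c₁ d₁)

    withM₂ : ∀ {A : Set} → (M2ₑ 8 → M2ₑ 8 → A) →
           Expr ℤ 8 → Expr ℤ 8 → Expr ℤ 8 → Expr ℤ 8 → Expr ℤ 8 → Expr ℤ 8 → Expr ℤ 8 → Expr ℤ 8 → A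
    withM₂ f a₁ b₁ c₁ d₁ a₂ b₂ c₂ d₂ = f (matₑ a₁ b₁ c₁ d₁) (matₑ a₂ b₂ c₂ d₂)

    withMk : ∀ {A : Set} → (M2ₑ 5 → Expr ℤ 5 → A) → Expr ℤ 5 → Expr ℤ 5 → Expr ℤ 5 → Expr ℤ 5 → Expr ℤ 5 → A
    withMk f a₁ b₁ c₁ d₁ k = f (matₑ a₁ b₁ c₁ d₁) k

    I2ₑ : ∀ {n} → M2ₑ n
    I2ₑ = matₑ 1ₑ 0ₑ 0ₑ 1ₑ

  det-*M : ∀ X Y → det (X *M Y) ≈ det X * det Y
  det-*M (mat a₁ b₁ c₁ d₁) (mat a₂ b₂ c₂ d₂) =
    solve 8 (withM₂ λ X Y → detₑ (X *ₑ Y) ⊜ detₑ X ⊗ detₑ Y) refl a₁ b₁ c₁ d₁ a₂ b₂ c₂ d₂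

  det-adj : ∀ X → det (adj X) ≈ det X
  det-adj (mat a₁ b₁ c₁ d₁) = solve 4 (withM λ X → detₑ (adjₑ X) ⊜ detₑ X) refl a₁ b₁ c₁ d₁

  det-difference : ∀ X Y → det (X -M Y) ≈ det X + det Y - tr (adj X *M Y)
  det-difference (mat a₁ b₁ c₁ d₁) (mat a₂ b₂ c₂ d₂) =
    solve 8 (withM₂ λ X Y → detₑ (X -ₑ Y) ⊜ detₑ X ⊕ detₑ Y ⊕ ⊝ trₑ (adjₑ X *ₑ Y)) refl a₁ b₁ c₁ d₁ a₂ b₂ c₂ d₂

  adj-*M-cancel : ∀ X Y → adj X *M (X *M Y) ≈M det X •M Y
  adj-*M-cancel (mat a₁ b₁ c₁ d₁) (mat a₂ b₂ c₂ d₂) =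
      solve 8 (withM₂ λ X Y → aₑ (adjₑ X *ₑ (X *ₑ Y)) ⊜ aₑ (detₑ X •ₑ Y)) refl a₁ b₁ c₁ d₁ a₂ b₂ c₂ d₂
    , solve 8 (withM₂ λ X Y → bₑ (adjₑ X *ₑ (X *ₑ Y)) ⊜ bₑ (detₑ X •ₑ Y)) refl a₁ b₁ c₁ d₁ a₂ b₂ c₂ d₂
    , solve 8 (withM₂ λ X Y → cₑ (adjₑ X *ₑ (X *ₑ Y)) ⊜ cₑ (detₑ X •ₑ Y)) refl a₁ b₁ c₁ d₁ a₂ b₂ c₂ d₂
    , solve 8 (withM₂ λ X Y → dₑ (adjₑ X *ₑ (X *ₑ Y)) ⊜ dₑ (detₑ X •ₑ Y)) refl a₁ b₁ c₁ d₁ a₂ b₂ c₂ d₂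

  *M-adj-cancel : ∀ X Y → X *M (adj X *M Y) ≈M det X •M Y
  *M-adj-cancel (mat a₁ b₁ c₁ d₁) (mat a₂ b₂ c₂ d₂) =
      solve 8 (withM₂ λ X Y → aₑ (X *ₑ (adjₑ X *ₑ Y)) ⊜ aₑ (detₑ X •ₑ Y)) refl a₁ b₁ c₁ d₁ a₂ b₂ c₂ d₂
    , solve 8 (withM₂ λ X Y → bₑ (X *ₑ (adjₑ X *ₑ Y)) ⊜ bₑ (detₑ X •ₑ Y)) refl a₁ b₁ c₁ d₁ a₂ b₂ c₂ d₂
    , solve 8 (withM₂ λ X Y → cₑ (X *ₑ (adjₑ X *ₑ Y)) ⊜ cₑ (detₑ X •ₑ Y)) refl a₁ b₁ c₁ d₁ a₂ b₂ c₂ d₂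
    , solve 8 (withM₂ λ X Y → dₑ (X *ₑ (adjₑ X *ₑ Y)) ⊜ dₑ (detₑ X •ₑ Y)) refl a₁ b₁ c₁ d₁ a₂ b₂ c₂ d₂

  det-cong : ∀ {X Y} → X ≈M Y → det X ≈ det Y
  det-cong (a≈ , b≈ , c≈ , d≈) = +-cong (*-cong a≈ d≈) (-‿cong (*-cong b≈ c≈))

  tr-cong : ∀ {X Y} → X ≈M Y → tr X ≈ tr Y
  tr-cong (a≈ , _ , _ , d≈) = +-cong a≈ d≈

  *M-congˡ : ∀ X {Y Y′} → Y ≈M Y′ → X *M Y ≈M X *M Y′
  *M-congˡ X (a≈ , b≈ , c≈ , d≈) = +-cong (*-congˡ a≈) (*-congˡ c≈) , +-cong (*-congˡ b≈) (*-congˡ d≈)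
                                  , +-cong (*-congˡ a≈) (*-congˡ c≈) , +-cong (*-congˡ b≈) (*-congˡ d≈)

  •M-identity : ∀ {k} X → k ≈ 1# → k •M X ≈M X
  •M-identity X k≈1 = unit (a X) , unit (b X) , unit (c X) , unit (d X)
    where
    unit : ∀ x → _ * x ≈ x
    unit x = trans (*-congʳ k≈1) (*-identityˡ x)

  det-I2 : det I2 ≈ 1#
  det-I2 = solve 0 (1ₑ ⊗ 1ₑ ⊕ ⊝ (0ₑ ⊗ 0ₑ) ⊜ 1ₑ) refl

  *M-•M-adj : ∀ X k → X *M (k •M adj X) ≈M (k * det X) •M I2
  *M-•M-adj (mat a₁ b₁ c₁ d₁) k =
      solve 5 (withMk λ X k → aₑ (X *ₑ (k •ₑ adjₑ X)) ⊜ aₑ ((k ⊗ detₑ X) •ₑ I2ₑ)) refl a₁ b₁ c₁ d₁ k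
    , solve 5 (withMk λ X k → bₑ (X *ₑ (k •ₑ adjₑ X)) ⊜ bₑ ((k ⊗ detₑ X) •ₑ I2ₑ)) refl a₁ b₁ c₁ d₁ k
    , solve 5 (withMk λ X k → cₑ (X *ₑ (k •ₑ adjₑ X)) ⊜ cₑ ((k ⊗ detₑ X) •ₑ I2ₑ)) refl a₁ b₁ c₁ d₁ k
    , solve 5 (withMk λ X k → dₑ (X *ₑ (k •ₑ adjₑ X)) ⊜ dₑ ((k ⊗ detₑ X) •ₑ I2ₑ)) refl a₁ b₁ c₁ d₁ k

  •M-adj-*M : ∀ X k → (k •M adj X) *M X ≈M (k * det X) •M I2
  •M-adj-*M (mat a₁ b₁ c₁ d₁) k =
      solve 5 (withMk λ X k → aₑ ((k •ₑ adjₑ X) *ₑ X) ⊜ aₑ ((k ⊗ detₑ X) •ₑ I2ₑ)) refl a₁ b₁ c₁ d₁ k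
    , solve 5 (withMk λ X k → bₑ ((k •ₑ adjₑ X) *ₑ X) ⊜ bₑ ((k ⊗ detₑ X) •ₑ I2ₑ)) refl a₁ b₁ c₁ d₁ k
    , solve 5 (withMk λ X k → cₑ ((k •ₑ adjₑ X) *ₑ X) ⊜ cₑ ((k ⊗ detₑ X) •ₑ I2ₑ)) refl a₁ b₁ c₁ d₁ k
    , solve 5 (withMk λ X k → dₑ ((k •ₑ adjₑ X) *ₑ X) ⊜ dₑ ((k ⊗ detₑ X) •ₑ I2ₑ)) refl a₁ b₁ c₁ d₁ k

  InGL2⇒det≉0 : ∀ X → InGL2 X → ¬ (det X ≈ 0#)
  InGL2⇒det≉0 X (Y , XY≈I , _) det≈0 = proj₁ isField (begin
    1#                ≈⟨ det-I2 ⟨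
    det I2            ≈⟨ det-cong XY≈I ⟨
    det (X *M Y)      ≈⟨ det-*M X Y ⟩
    det X * det Y     ≈⟨ *-congʳ det≈0 ⟩
    0# * det Y        ≈⟨ zeroˡ _ ⟩
    0#                ∎)

  det≉0⇒InGL2 : ∀ X → ¬ (det X ≈ 0#) → InGL2 X
  det≉0⇒InGL2 X det≉0 = k •M adj X
                       , ≈M.trans (*M-•M-adj X k) (•M-identity I2 k*det≈1)
                       , ≈M.trans (•M-adj-*M X k) (•M-identity I2 k*det≈1)
    where
    k = proj₁ (proj₂ isField (det X) det≉0)
    k*det≈1 = trans (*-comm k (det X)) (proj₂ (proj₂ isField (det X) det≉0))

  det-*M-≈1 : ∀ {X Y} → det X ≈ 1# → det Y ≈ 1# → det (X *M Y) ≈ 1#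
  det-*M-≈1 {X} {Y} detX≈1 detY≈1 = begin
    det (X *M Y)   ≈⟨ det-*M X Y ⟩
    det X * det Y  ≈⟨ *-cong detX≈1 detY≈1 ⟩
    1# * 1#        ≈⟨ *-identityˡ 1# ⟩
    1#             ∎

  -- For det C = 1, tr C = 2 exactly when C is unipotent.
  NonUnipotentSL2 : M2 F → Set
  NonUnipotentSL2 C = det C ≈ 1# × ¬ (tr C ≈ 2#)

  NonUnipotentSL2-resp : NonUnipotentSL2 Respects _≈M_
  NonUnipotentSL2-resp X≈Y (detX≈1 , trX≉2) =
    trans (sym (det-cong X≈Y)) detX≈1 , λ trY≈2 → trX≉2 (trans (tr-cong X≈Y) trY≈2)

  module _ {A : M2 F} (detA≈1 : det A ≈ 1#) where

    adj-*M-cancel-SL2 : ∀ C → adj A *M (A *M C) ≈M C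
    adj-*M-cancel-SL2 C = ≈M.trans (adj-*M-cancel A C) (•M-identity C detA≈1)

    *M-adj-cancel-SL2 : ∀ B → A *M (adj A *M B) ≈M B
    *M-adj-cancel-SL2 B = ≈M.trans (*M-adj-cancel A B) (•M-identity B detA≈1)

    det-difference-SL2 : ∀ {B} → det B ≈ 1# → det (A -M B) ≈ 2# - tr (adj A *M B)
    det-difference-SL2 {B} detB≈1 = trans (det-difference A B) (+-congʳ (+-cong detA≈1 detB≈1))

    InGL2-M⇒tr≉2 : ∀ {B} → det B ≈ 1# → InGL2 (A -M B) → ¬ (tr (adj A *M B) ≈ 2#)
    InGL2-M⇒tr≉2 {B} detB≈1 A-B∈GL2 tr≈2 = InGL2⇒det≉0 (A -M B) A-B∈GL2 (begin
      det (A -M B)          ≈⟨ det-difference-SL2 detB≈1 ⟩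
      2# - tr (adj A *M B)  ≈⟨ +-congˡ (-‿cong tr≈2) ⟩
      2# - 2#               ≈⟨ -‿inverseʳ _ ⟩
      0#                    ∎)

    tr≉2⇒InGL2-M : ∀ {B} → det B ≈ 1# → ¬ (tr (adj A *M B) ≈ 2#) → InGL2 (A -M B)
    tr≉2⇒InGL2-M {B} detB≈1 tr≉2 = det≉0⇒InGL2 (A -M B) λ det≈0 →
      tr≉2 (sym (x∙y⁻¹≈ε⇒x≈y _ _ (trans (sym (det-difference-SL2 detB≈1)) det≈0)))

  Nbhd11↔NonUnipotentSL2 : (A : SL2 F) → Inverse (Nbhd11 F A) (M2-setoid ↾ NonUnipotentSL2)
  Nbhd11↔NonUnipotentSL2 (A , detA≈1) = record
    { to        = λ ((B , detB≈1) , A-B∈GL2) →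
                    adj A *M B , det-*M-≈1 (trans (det-adj A) detA≈1) detB≈1 , InGL2-M⇒tr≉2 detA≈1 detB≈1 A-B∈GL2
    ; from      = λ (C , detC≈1 , trC≉2) →
                    (A *M C , det-*M-≈1 detA≈1 detC≈1) ,
                    tr≉2⇒InGL2-M detA≈1 (det-*M-≈1 detA≈1 detC≈1)
                      (λ tr≈2 → trC≉2 (trans (tr-cong (≈M.sym (adj-*M-cancel-SL2 detA≈1 C))) tr≈2))
    ; to-cong   = *M-congˡ (adj A)
    ; from-cong = *M-congˡ A
    ; inverse   = (λ {C} B≈AC → ≈M.trans (*M-congˡ (adj A) B≈AC) (adj-*M-cancel-SL2 detA≈1 (proj₁ C)))
                , (λ {B} C≈A⁻¹B → ≈M.trans (*M-congˡ A C≈A⁻¹B) (*M-adj-cancel-SL2 detA≈1 (proj₁ (proj₁ B))))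
    }

module FiniteField (F : CommutativeRing 0ℓ 0ℓ) (isField : IsField F) {q : ℕ} (card : HasCard F q) where
  open CommutativeRing F
  open FinCounting
  open import Data.Empty using (⊥-elim)
  open import Data.Fin as Fin using (combine)
  open import Data.Nat.Tactic.RingSolver using (solve-∀)
  open import Function using (_∘_)
  open import Function.Bundles using (_⇔_; mk⇔)
  open import Function.Properties.Inverse using (Inverse⇒Injection)
  open import Function.Related.TypeIsomorphisms using (¬-cong-⇔)
  open import Relation.Nullary using (yes; no; ¬_)
  open import Relation.Nullary.Decidable using (¬?; _×-dec_; via-injection)
  open import Relation.Binary.Definitions using (Decidable)
  import Relation.Unary
  open Matrices F isField
  open Inverse card using (to; from; strictlyInverseˡ; strictlyInverseʳ) renaming (to-cong to to-cong′)
  open ≡.≡-Reasoning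

  infix 4 _≟_
  _≟_ : Decidable _≈_
  _≟_ = via-injection (Inverse⇒Injection card) Fin._≟_

  open DiscreteField F isField _≟_

  [_≈_] [_≉_] : Carrier → Carrier → ℕ
  [ x ≈ y ] = iverson (x ≟ y)
  [ x ≉ y ] = iverson (¬? (x ≟ y))

  ∑F-syntax : (Carrier → ℕ) → ℕ
  ∑F-syntax g = ∑[ i < q ] g (from i)

  infix 10 ∑F-syntax
  syntax ∑F-syntax (λ x → e) = ∑F[ x ] e

  Respects≈ : (Carrier → ℕ) → Set
  Respects≈ g = ∀ {x y} → x ≈ y → g x ≡ g y

  ∑F-cong : ∀ {g h : Carrier → ℕ} → (∀ x → g x ≡ h x) → ∑F[ x ] g x ≡ ∑F[ x ] h x
  ∑F-cong g≗h = sum-cong-≗ (g≗h ∘ from)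

  ∑F-+ : ∀ (g h : Carrier → ℕ) → ∑F[ x ] (g x ℕ.+ h x) ≡ ∑F[ x ] g x ℕ.+ ∑F[ x ] h x
  ∑F-+ g h = ∑-distrib-+ (g ∘ from) (h ∘ from)

  ∑F-*ˡ : ∀ k (g : Carrier → ℕ) → ∑F[ x ] (k ℕ.* g x) ≡ k ℕ.* ∑F[ x ] g x
  ∑F-*ˡ k g = ≡.sym (*-distribˡ-sum k (g ∘ from))

  ∑F-const : ∀ k → ∑F[ x ] k ≡ q ℕ.* k
  ∑F-const = ∑-const q

  ∑F-≈ : ∀ c → ∑F[ x ] [ x ≈ c ] ≡ 1
  ∑F-≈ c = ≡.trans (sum-cong-≗ λ i → iverson-cong (from i ≟ c) (i Fin.≟ to c) (mk⇔ from≈c⇒≡to-c ≡to-c⇒from≈c))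
                   (∑-δ q (to c))
    where
    from≈c⇒≡to-c : ∀ {i} → from i ≈ c → i ≡ to c
    from≈c⇒≡to-c {i} e = ≡.trans (≡.sym (strictlyInverseˡ i)) (to-cong′ e)
    ≡to-c⇒from≈c : ∀ {i} → i ≡ to c → from i ≈ c
    ≡to-c⇒from≈c ≡.refl = strictlyInverseʳ c

  ∑F-≉ : ∀ c → ∑F[ x ] [ x ≉ c ] ≡ q ∸ 1
  ∑F-≉ c = begin
    ≉c                                   ≡⟨ ℕ.m+n∸m≡n 1 ≉c ⟨
    1 ℕ.+ ≉c ∸ 1                         ≡⟨ ≡.cong (λ n → n ℕ.+ ≉c ∸ 1) (∑F-≈ c) ⟨
    ∑F[ x ] [ x ≈ c ] ℕ.+ ≉c ∸ 1         ≡⟨ ≡.cong (_∸ 1) (∑F-+ (λ x → [ x ≈ c ]) (λ x → [ x ≉ c ])) ⟨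
    ∑F[ x ] ([ x ≈ c ] ℕ.+ [ x ≉ c ]) ∸ 1 ≡⟨ ≡.cong (_∸ 1) (∑F-cong (iverson-+-¬ ∘ (_≟ c))) ⟩
    ∑F[ x ] 1 ∸ 1                        ≡⟨ ≡.cong (_∸ 1) (≡.trans (∑F-const 1) (ℕ.*-identityʳ q)) ⟩
    q ∸ 1                                ∎
    where ≉c = ∑F[ x ] [ x ≉ c ]

  ∑F-pick : ∀ c (g : Carrier → ℕ) → Respects≈ g → ∑F[ x ] ([ x ≈ c ] ℕ.* g x) ≡ g c
  ∑F-pick c g g-resp = begin
    ∑F[ x ] ([ x ≈ c ] ℕ.* g x)  ≡⟨ ∑F-cong pointwise ⟩
    ∑F[ x ] (g c ℕ.* [ x ≈ c ])  ≡⟨ ∑F-*ˡ (g c) (λ x → [ x ≈ c ]) ⟩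
    g c ℕ.* ∑F[ x ] [ x ≈ c ]    ≡⟨ ≡.cong (g c ℕ.*_) (∑F-≈ c) ⟩
    g c ℕ.* 1                    ≡⟨ ℕ.*-identityʳ (g c) ⟩
    g c                          ∎
    where
    pointwise : ∀ x → [ x ≈ c ] ℕ.* g x ≡ g c ℕ.* [ x ≈ c ]
    pointwise x with x ≟ c
    ... | yes x≈c = ≡.trans (ℕ.+-identityʳ (g x)) (≡.trans (g-resp x≈c) (≡.sym (ℕ.*-identityʳ (g c))))
    ... | no _    = ≡.sym (ℕ.*-zeroʳ (g c))

  ∑F-split : ∀ c (g : Carrier → ℕ) → Respects≈ g → ∑F[ x ] g x ≡ g c ℕ.+ ∑F[ x ] ([ x ≉ c ] ℕ.* g x)
  ∑F-split c g g-resp = begin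
    ∑F[ x ] g x                                       ≡⟨ ∑F-cong pointwise ⟩
    ∑F[ x ] ([ x ≈ c ] ℕ.* g x ℕ.+ [ x ≉ c ] ℕ.* g x) ≡⟨ ∑F-+ (λ x → [ x ≈ c ] ℕ.* g x) (λ x → [ x ≉ c ] ℕ.* g x) ⟩
    ∑F[ x ] ([ x ≈ c ] ℕ.* g x) ℕ.+ rest              ≡⟨ ≡.cong (ℕ._+ rest) (∑F-pick c g g-resp) ⟩
    g c ℕ.+ rest                                      ∎
    where
    rest = ∑F[ x ] ([ x ≉ c ] ℕ.* g x)
    pointwise : ∀ x → g x ≡ [ x ≈ c ] ℕ.* g x ℕ.+ [ x ≉ c ] ℕ.* g x
    pointwise x = begin
      g x                                        ≡⟨ ℕ.*-identityˡ (g x) ⟨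
      1 ℕ.* g x                                  ≡⟨ ≡.cong (ℕ._* g x) (iverson-+-¬ (x ≟ c)) ⟨
      ([ x ≈ c ] ℕ.+ [ x ≉ c ]) ℕ.* g x          ≡⟨ ℕ.*-distribʳ-+ (g x) [ x ≈ c ] [ x ≉ c ] ⟩
      [ x ≈ c ] ℕ.* g x ℕ.+ [ x ≉ c ] ℕ.* g x    ∎

  ∑F-x*y≈k : ∀ {x} k → ¬ (x ≈ 0#) → ∑F[ y ] [ x * y ≈ k ] ≡ 1
  ∑F-x*y≈k {x} k x≉0 = ≡.trans
    (∑F-cong λ y → iverson-cong (x * y ≟ k) (y ≟ x⁻¹ * k) (x*y≈1⇒[x*z≈w⇔z≈y*w] x*x⁻¹≈1))
    (∑F-≈ (x⁻¹ * k))
    where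
    x⁻¹ = proj₁ (proj₂ isField x x≉0)
    x*x⁻¹≈1 = proj₂ (proj₂ isField x x≉0)

  ∑F-0*y≈k : ∀ k → ∑F[ y ] [ 0# * y ≈ k ] ≡ q ℕ.* [ k ≈ 0# ]
  ∑F-0*y≈k k = ≡.trans (∑F-cong pointwise) (∑F-const [ k ≈ 0# ])
    where
    pointwise : ∀ y → [ 0# * y ≈ k ] ≡ [ k ≈ 0# ]
    pointwise y = iverson-cong (0# * y ≟ k) (k ≟ 0#)
      (mk⇔ (λ 0y≈k → trans (sym 0y≈k) (zeroˡ y)) (λ k≈0 → trans (zeroˡ y) (sym k≈0)))

  ∑F∑F-x*y≈k : ∀ k → ∑F[ x ] ∑F[ y ] [ x * y ≈ k ] ≡ q ℕ.* [ k ≈ 0# ] ℕ.+ (q ∸ 1)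
  ∑F∑F-x*y≈k k = begin
    ∑F[ x ] solutions x                                    ≡⟨ ∑F-split 0# solutions solutions-resp ⟩
    solutions 0# ℕ.+ ∑F[ x ] ([ x ≉ 0# ] ℕ.* solutions x) ≡⟨ ≡.cong₂ ℕ._+_ (∑F-0*y≈k k) (∑F-cong pointwise) ⟩
    q ℕ.* [ k ≈ 0# ] ℕ.+ ∑F[ x ] [ x ≉ 0# ]               ≡⟨ ≡.cong (q ℕ.* [ k ≈ 0# ] ℕ.+_) (∑F-≉ 0#) ⟩
    q ℕ.* [ k ≈ 0# ] ℕ.+ (q ∸ 1)                          ∎
    where
    solutions : Carrier → ℕ
    solutions x = ∑F[ y ] [ x * y ≈ k ]
    solutions-resp : Respects≈ solutions
    solutions-resp x≈x′ = ∑F-cong λ y →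
      iverson-cong (_ * y ≟ k) (_ * y ≟ k) (mk⇔ (trans (*-congʳ (sym x≈x′))) (trans (*-congʳ x≈x′)))
    pointwise : ∀ x → [ x ≉ 0# ] ℕ.* solutions x ≡ [ x ≉ 0# ]
    pointwise x with x ≟ 0#
    ... | yes _  = ≡.refl
    ... | no x≉0 = ≡.trans (ℕ.+-identityʳ (solutions x)) (∑F-x*y≈k k x≉0)

  ∑F-x+y≉z : ∀ x z → ∑F[ y ] [ x + y ≉ z ] ≡ q ∸ 1
  ∑F-x+y≉z x z = ≡.trans
    (∑F-cong λ y → iverson-cong (¬? (x + y ≟ z)) (¬? (y ≟ z - x)) (¬-cong-⇔ x+y≈z⇔y≈z-x))
    (∑F-≉ (z - x))

  ∑F-x+y≉2-x*y≈1 : ∀ x → ∑F[ y ] ([ x + y ≉ 2# ] ℕ.* [ x * y ≈ 1# ]) ≡ [ x ≉ 0# ] ℕ.* [ x ≉ 1# ]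
  ∑F-x+y≉2-x*y≈1 x with x ≟ 0#
  ... | yes x≈0 = ≡.trans (∑F-cong pointwise) (≡.trans (∑F-const 0) (ℕ.*-zeroʳ q))
    where
    pointwise : ∀ y → [ x + y ≉ 2# ] ℕ.* [ x * y ≈ 1# ] ≡ 0
    pointwise y = ≡.trans (≡.cong ([ x + y ≉ 2# ] ℕ.*_) (iverson-no (x * y ≟ 1#) xy≉1)) (ℕ.*-zeroʳ [ x + y ≉ 2# ])
      where xy≉1 = λ xy≈1 → 1≉0 (trans (sym xy≈1) (trans (*-congʳ x≈0) (zeroˡ y)))
  ... | no x≉0 = begin
    ∑F[ y ] ([ x + y ≉ 2# ] ℕ.* [ x * y ≈ 1# ]) ≡⟨ ∑F-cong pointwise ⟩
    ∑F[ y ] ([ y ≈ x⁻¹ ] ℕ.* [ x + y ≉ 2# ])    ≡⟨ ∑F-pick x⁻¹ (λ y → [ x + y ≉ 2# ]) [x+_≉2]-resp ⟩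
    [ x + x⁻¹ ≉ 2# ]                            ≡⟨ iverson-cong (¬? (x + x⁻¹ ≟ 2#)) (¬? (x ≟ 1#)) (¬-cong-⇔ x+x⁻¹≈2⇔x≈1) ⟩
    [ x ≉ 1# ]                                  ≡⟨ ℕ.+-identityʳ [ x ≉ 1# ] ⟨
    1 ℕ.* [ x ≉ 1# ]                            ∎
    where
    x⁻¹ = proj₁ (proj₂ isField x x≉0)
    x*x⁻¹≈1 = proj₂ (proj₂ isField x x≉0)
    pointwise : ∀ y → [ x + y ≉ 2# ] ℕ.* [ x * y ≈ 1# ] ≡ [ y ≈ x⁻¹ ] ℕ.* [ x + y ≉ 2# ]
    pointwise y = ≡.trans (ℕ.*-comm [ x + y ≉ 2# ] [ x * y ≈ 1# ])
      (≡.cong (ℕ._* [ x + y ≉ 2# ]) (iverson-cong (x * y ≟ 1#) (y ≟ x⁻¹) (x*y≈1⇒[x*z≈1⇔z≈y] x*x⁻¹≈1)))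
    [x+_≉2]-resp : Respects≈ (λ y → [ x + y ≉ 2# ])
    [x+_≉2]-resp y≈y′ = iverson-cong (¬? (x + _ ≟ 2#)) (¬? (x + _ ≟ 2#))
      (¬-cong-⇔ (mk⇔ (trans (+-congˡ (sym y≈y′))) (trans (+-congˡ y≈y′))))
    x+x⁻¹≈2⇔x≈1 : (x + x⁻¹ ≈ 2#) ⇔ (x ≈ 1#)
    x+x⁻¹≈2⇔x≈1 = mk⇔ (x*y≈1⇒[x+y≈2⇒x≈1] x*x⁻¹≈1) λ x≈1 →
      +-cong x≈1 (trans (sym (*-identityˡ x⁻¹)) (trans (*-congʳ (sym x≈1)) x*x⁻¹≈1))

  ∑F-≉0-≉1 : ∑F[ x ] ([ x ≉ 0# ] ℕ.* [ x ≉ 1# ]) ℕ.+ 2 ≡ q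
  ∑F-≉0-≉1 = begin
    ∑F[ x ] g x ℕ.+ 2
      ≡⟨ ≡.cong (∑F[ x ] g x ℕ.+_) (≡.cong₂ ℕ._+_ (∑F-≈ 0#) (∑F-≈ 1#)) ⟨
    ∑F[ x ] g x ℕ.+ (∑F[ x ] [ x ≈ 0# ] ℕ.+ ∑F[ x ] [ x ≈ 1# ])
      ≡⟨ ≡.cong (∑F[ x ] g x ℕ.+_) (∑F-+ (λ x → [ x ≈ 0# ]) (λ x → [ x ≈ 1# ])) ⟨
    ∑F[ x ] g x ℕ.+ ∑F[ x ] ([ x ≈ 0# ] ℕ.+ [ x ≈ 1# ])
      ≡⟨ ∑F-+ g (λ x → [ x ≈ 0# ] ℕ.+ [ x ≈ 1# ]) ⟨
    ∑F[ x ] (g x ℕ.+ ([ x ≈ 0# ] ℕ.+ [ x ≈ 1# ]))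
      ≡⟨ ∑F-cong pointwise ⟩
    ∑F[ x ] 1
      ≡⟨ ≡.trans (∑F-const 1) (ℕ.*-identityʳ q) ⟩
    q
      ∎
    where
    g : Carrier → ℕ
    g x = [ x ≉ 0# ] ℕ.* [ x ≉ 1# ]
    pointwise : ∀ x → g x ℕ.+ ([ x ≈ 0# ] ℕ.+ [ x ≈ 1# ]) ≡ 1
    pointwise x with x ≟ 0# | x ≟ 1#
    ... | yes x≈0 | yes x≈1 = ⊥-elim (1≉0 (trans (sym x≈1) x≈0))
    ... | yes _   | no _    = ≡.refl
    ... | no _    | yes _   = ≡.refl
    ... | no _    | no _    = ≡.refl

  NonUnipotentSL2? : Relation.Unary.Decidable NonUnipotentSL2
  NonUnipotentSL2? C = (det C ≟ 1#) ×-dec ¬? (tr C ≟ 2#)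

  [NonUnipotentSL2] : M2 F → ℕ
  [NonUnipotentSL2] = iverson ∘ NonUnipotentSL2?

  ∑∑-[NonUnipotentSL2] : ∀ a d →
    ∑F[ b ] ∑F[ c ] [NonUnipotentSL2] (mat a b c d) ≡ [ a + d ≉ 2# ] ℕ.* (q ℕ.* [ a * d ≈ 1# ] ℕ.+ (q ∸ 1))
  ∑∑-[NonUnipotentSL2] a d = begin
    ∑F[ b ] ∑F[ c ] [NonUnipotentSL2] (mat a b c d)
      ≡⟨ ∑F-cong (λ b → ∑F-cong (pointwise b)) ⟩
    ∑F[ b ] ∑F[ c ] (tr≉2 ℕ.* [ b * c ≈ a * d - 1# ])
      ≡⟨ ∑F-cong (λ b → ∑F-*ˡ tr≉2 (λ c → [ b * c ≈ a * d - 1# ])) ⟩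
    ∑F[ b ] (tr≉2 ℕ.* ∑F[ c ] [ b * c ≈ a * d - 1# ])
      ≡⟨ ∑F-*ˡ tr≉2 (λ b → ∑F[ c ] [ b * c ≈ a * d - 1# ]) ⟩
    tr≉2 ℕ.* ∑F[ b ] ∑F[ c ] [ b * c ≈ a * d - 1# ]
      ≡⟨ ≡.cong (tr≉2 ℕ.*_) (∑F∑F-x*y≈k (a * d - 1#)) ⟩
    tr≉2 ℕ.* (q ℕ.* [ a * d - 1# ≈ 0# ] ℕ.+ (q ∸ 1))
      ≡⟨ ≡.cong (λ n → tr≉2 ℕ.* (q ℕ.* n ℕ.+ (q ∸ 1))) (iverson-cong (a * d - 1# ≟ 0#) (a * d ≟ 1#) x-y≈0⇔x≈y) ⟩
    tr≉2 ℕ.* (q ℕ.* [ a * d ≈ 1# ] ℕ.+ (q ∸ 1))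
      ∎
    where
    tr≉2 = [ a + d ≉ 2# ]
    pointwise : ∀ b c → [NonUnipotentSL2] (mat a b c d) ≡ tr≉2 ℕ.* [ b * c ≈ a * d - 1# ]
    pointwise b c = begin
      [NonUnipotentSL2] (mat a b c d)
        ≡⟨ iverson-× (det (mat a b c d) ≟ 1#) (¬? (a + d ≟ 2#)) ⟩
      [ det (mat a b c d) ≈ 1# ] ℕ.* tr≉2
        ≡⟨ ℕ.*-comm [ det (mat a b c d) ≈ 1# ] tr≉2 ⟩
      tr≉2 ℕ.* [ det (mat a b c d) ≈ 1# ]
        ≡⟨ ≡.cong (tr≉2 ℕ.*_) (iverson-cong (det (mat a b c d) ≟ 1#) (b * c ≟ a * d - 1#) x-y≈z⇔y≈x-z) ⟩
      tr≉2 ℕ.* [ b * c ≈ a * d - 1# ]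
        ∎

  ∑∑∑-[NonUnipotentSL2] : ∀ a → ∑F[ d ] ∑F[ b ] ∑F[ c ] [NonUnipotentSL2] (mat a b c d) ≡
                                q ℕ.* ([ a ≉ 0# ] ℕ.* [ a ≉ 1# ]) ℕ.+ (q ∸ 1) ℕ.* (q ∸ 1)
  ∑∑∑-[NonUnipotentSL2] a = begin
    ∑F[ d ] ∑F[ b ] ∑F[ c ] [NonUnipotentSL2] (mat a b c d)
      ≡⟨ ∑F-cong (λ d → ≡.trans (∑∑-[NonUnipotentSL2] a d) (distribute d)) ⟩
    ∑F[ d ] (q ℕ.* h d ℕ.+ (q ∸ 1) ℕ.* tr≉2 d)
      ≡⟨ ∑F-+ (λ d → q ℕ.* h d) (λ d → (q ∸ 1) ℕ.* tr≉2 d) ⟩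
    ∑F[ d ] (q ℕ.* h d) ℕ.+ ∑F[ d ] ((q ∸ 1) ℕ.* tr≉2 d)
      ≡⟨ ≡.cong₂ ℕ._+_ (∑F-*ˡ q h) (∑F-*ˡ (q ∸ 1) tr≉2) ⟩
    q ℕ.* ∑F[ d ] h d ℕ.+ (q ∸ 1) ℕ.* ∑F[ d ] tr≉2 d
      ≡⟨ ≡.cong₂ (λ m n → q ℕ.* m ℕ.+ (q ∸ 1) ℕ.* n) (∑F-x+y≉2-x*y≈1 a) (∑F-x+y≉z a 2#) ⟩
    q ℕ.* ([ a ≉ 0# ] ℕ.* [ a ≉ 1# ]) ℕ.+ (q ∸ 1) ℕ.* (q ∸ 1)
      ∎
    where
    tr≉2 h : Carrier → ℕ
    tr≉2 d = [ a + d ≉ 2# ]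
    h d = tr≉2 d ℕ.* [ a * d ≈ 1# ]
    *-distrib-shape : ∀ t e q s → t ℕ.* (q ℕ.* e ℕ.+ s) ≡ q ℕ.* (t ℕ.* e) ℕ.+ s ℕ.* t
    *-distrib-shape = solve-∀
    distribute : ∀ d → tr≉2 d ℕ.* (q ℕ.* [ a * d ≈ 1# ] ℕ.+ (q ∸ 1)) ≡ q ℕ.* h d ℕ.+ (q ∸ 1) ℕ.* tr≉2 d
    distribute d = *-distrib-shape (tr≉2 d) [ a * d ≈ 1# ] q (q ∸ 1)

  ∑⁴-[NonUnipotentSL2] : ∑F[ a ] ∑F[ d ] ∑F[ b ] ∑F[ c ] [NonUnipotentSL2] (mat a b c d) ≡ q ^ 3 ∸ q ^ 2 ∸ q
  ∑⁴-[NonUnipotentSL2] = begin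
    ∑F[ a ] ∑F[ d ] ∑F[ b ] ∑F[ c ] [NonUnipotentSL2] (mat a b c d)
      ≡⟨ ∑F-cong ∑∑∑-[NonUnipotentSL2] ⟩
    ∑F[ a ] (q ℕ.* g a ℕ.+ (q ∸ 1) ℕ.* (q ∸ 1))
      ≡⟨ ∑F-+ (λ a → q ℕ.* g a) (λ _ → (q ∸ 1) ℕ.* (q ∸ 1)) ⟩
    ∑F[ a ] (q ℕ.* g a) ℕ.+ ∑F[ a ] ((q ∸ 1) ℕ.* (q ∸ 1))
      ≡⟨ ≡.cong₂ ℕ._+_ (∑F-*ˡ q g) (∑F-const ((q ∸ 1) ℕ.* (q ∸ 1))) ⟩
    q ℕ.* ∑F[ a ] g a ℕ.+ q ℕ.* ((q ∸ 1) ℕ.* (q ∸ 1))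
      ≡⟨ q*m+q*[q-1]²≡q³-q²-q (≡.trans (ℕ.+-comm 2 (∑F[ a ] g a)) ∑F-≉0-≉1) ⟩
    q ^ 3 ∸ q ^ 2 ∸ q
      ∎
    where
    g : Carrier → ℕ
    g a = [ a ≉ 0# ] ℕ.* [ a ≉ 1# ]

  private
    N : ℕ
    N = q ℕ.* (q ℕ.* (q ℕ.* q))

  -- Entries are listed as a, d, b, c, so that summing over the encoding gives
  -- the sums above, whose two innermost ones count the solutions of bc = ad − 1.
  encode : M2 F → Fin N
  encode X = pair⁴ (to (a X) , to (d X) , to (b X) , to (c X))

  fromEntries : Fin q × Fin q × Fin q × Fin q → M2 F
  fromEntries (i , l , j , m) = mat (from i) (from j) (from m) (from l)

  decode : Fin N → M2 F
  decode = fromEntries ∘ unpair⁴ q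

  encode-cong : ∀ {X Y} → X ≈M Y → encode X ≡ encode Y
  encode-cong (a≈ , b≈ , c≈ , d≈) =
    ≡.cong pair⁴ (≡.cong₂ _,_ (to-cong′ a≈) (≡.cong₂ _,_ (to-cong′ d≈) (≡.cong₂ _,_ (to-cong′ b≈) (to-cong′ c≈))))

  encode-decode : ∀ k → encode (decode k) ≡ k
  encode-decode k = ≡.trans
    (≡.cong pair⁴ (≡.cong₂ _,_ (strictlyInverseˡ i) (≡.cong₂ _,_ (strictlyInverseˡ l)
                  (≡.cong₂ _,_ (strictlyInverseˡ j) (strictlyInverseˡ m)))))
    (pair⁴-unpair⁴ q k)
    where
    i l j m : Fin q
    i = proj₁ (unpair⁴ q k)
    l = proj₁ (proj₂ (unpair⁴ q k))
    j = proj₁ (proj₂ (proj₂ (unpair⁴ q k)))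
    m = proj₂ (proj₂ (proj₂ (unpair⁴ q k)))

  decode-encode : ∀ X → decode (encode X) ≈M X
  decode-encode X =
    ≡.subst (_≈M X) (≡.cong fromEntries (≡.sym (unpair⁴-pair⁴ (to (a X) , to (d X) , to (b X) , to (c X)))))
      (strictlyInverseʳ (a X) , strictlyInverseʳ (b X) , strictlyInverseʳ (c X) , strictlyInverseʳ (d X))

  M2↔Fin : Inverse M2-setoid (≡.setoid (Fin N))
  M2↔Fin = record
    { to        = encode
    ; from      = decode
    ; to-cong   = encode-cong
    ; from-cong = λ { ≡.refl → ≈M.refl }
    ; inverse   = (λ {k} X≈decode-k → ≡.trans (encode-cong X≈decode-k) (encode-decode k))
                , (λ { {X} ≡.refl → decode-encode X })
    }

  ∑-decode : ∀ (h : M2 F → ℕ) → ∑[ k < N ] h (decode k) ≡ ∑F[ a ] ∑F[ d ] ∑F[ b ] ∑F[ c ] h (mat a b c d)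
  ∑-decode h =
    ≡.trans (∑-combine q (q ℕ.* (q ℕ.* q)) (h ∘ decode)) (sum-cong-≗ λ i →
    ≡.trans (∑-combine q (q ℕ.* q) (h ∘ decode ∘ combine i)) (sum-cong-≗ λ l →
    ≡.trans (∑-combine q q (h ∘ decode ∘ combine i ∘ combine l)) (sum-cong-≗ λ j → sum-cong-≗ λ m →
    ≡.cong (h ∘ fromEntries) (unpair⁴-pair⁴ (i , l , j , m)))))

lemma6p2 : (q p n : ℕ) → Prime p → q ≡ p ^ suc n →
    (F : CommutativeRing 0ℓ 0ℓ) → IsField F → HasCard F q →
    G11-Regular F (q ^ 3 ∸ q ^ 2 ∸ q)
lemma6p2 q p n _ _ F isField card A =
  ≡.subst (λ k → Inverse (Nbhd11 F A) (≡.setoid (Fin k)))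
    (≡.trans (∑-decode [NonUnipotentSL2]) ∑⁴-[NonUnipotentSL2])
    (Composition.inverse (Nbhd11↔NonUnipotentSL2 A) (↾↔∑ M2↔Fin NonUnipotentSL2? NonUnipotentSL2-resp))
  where
  open Matrices F isField using (Nbhd11↔NonUnipotentSL2; NonUnipotentSL2-resp)
  open FinCounting using (↾↔∑)
  open FiniteField F isField card using (M2↔Fin; NonUnipotentSL2?; [NonUnipotentSL2]; ∑-decode; ∑⁴-[NonUnipotentSL2])
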